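{- Let $A$ be a list of $r$-coordinates that is sorted under the simple ordering $(1,2,\ldots,r)$, and let $\sigma$ be a complete ordering. Then the sequence of $\textsc{PartialSort}$ calls performed by $\textsc{QuesadillaSort}(A,\sigma)$ results in the list of coordinates of $A$ sorted under $\sigma$.
   Context: An $r$-coordinate is a tuple $(i_1,\ldots,i_r)$ of integers with $1\le i_m\le n_m$; position $m$ is mode $m$. A complete ordering is a tuple of all $r$ modes in some order (a permutation of $(1,\ldots,r)$). Coordinates are compared lexicographically under an ordering $\sigma$: $i<i'$ if $i_{\sigma_1}<i'_{\sigma_1}$, or $i_{\sigma_1}=i'_{\sigma_1}$ and $i<i'$ under $(\sigma_2,\ldots)$; all tuples are equal under $()$. A list is sorted under $\sigma$ if nondecreasing in this order. For $A$ sorted under a complete ordering $\tau$ and $0\le l<k\le r$, $\textsc{PartialSort}(A,(\tau_1,\ldots,\tau_l),\tau_k)$ returns the coordinates of $A$ rearranged to be sorted under $(\tau_1,\ldots,\tau_l,\tau_k,\tau_{l+1},\ldots,\tau_{k-1},\tau_{k+1},\ldots,\tau_r)$. For a complete ordering $\tau$ and mode $p=\tau_k$, $f(\tau,p)=\{\tau_{k+1},\ldots,\tau_r\}$. $\textsc{QuesadillaSort}(A,\sigma)$ is the procedure (indices 1-based): set $l\gets0$; while $l<r$: set $k\gets l$; while $k+1<r$ and $f(\sigma,\sigma_{k+1})\not\subseteq f((1,2,\ldots,r),\sigma_{k+1})$, set $k\gets k+1$; set $l'\gets k+1$; while $k>l$: set $A\gets\textsc{PartialSort}(A,(\sigma_1,\ldots,\sigma_l),\sigma_k)$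 and $k\gets k-1$; then set $l\gets l'$. Finally return $A$. -}

module Defs where

open import Data.Nat using (ℕ; zero; suc; _+_; _∸_; _<_; _≤_; _<ᵇ_)
open import Data.Nat.Properties using (_<?_; _≟_)
open import Data.Fin using (Fin; toℕ)
open import Data.Fin.Properties using () renaming (_≟_ to _≟F_)
open import Data.List using (List; []; _∷_; _++_; take; drop; filter; allFin; map)
open import Data.List.Relation.Unary.Linked using (Linked; linked?)
open import Data.List.Relation.Unary.All using (all?)
open import Data.List.Relation.Unary.Any using (any?)
open import Data.Bool using (Bool; true; false; if_then_else_; _∧_; not)
open import Data.Maybe using (Maybe; just; nothing; _>>=_)
open import Data.Product using (_×_; _,_; proj₁)
open import Data.Sum using (_⊎_; inj₁; inj₂)
open import Data.Unit using (⊤; tt)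
open import Relation.Nullary using (Dec; yes; no; does; ¬_)
open import Relation.Nullary.Decidable using (_⊎-dec_; _×-dec_)
open import Relation.Binary.PropositionalEquality using (_≡_)

-- Modes are 0-based: Fin r (mode m+1 of the paper is the element m of Fin r).
-- An r-coordinate: mode m ↦ index i_m.
Coord : ℕ → Set
Coord r = Fin r → ℕ

InBounds : ∀ {r} → (Fin r → ℕ) → Coord r → Set
InBounds n i = ∀ m → 1 ≤ i m × i m ≤ n m

Ordering : ℕ → Set
Ordering r = List (Fin r)

LexLe : ∀ {r} → Ordering r → Coord r → Coord r → Set
LexLe []      i i' = ⊤
LexLe (m ∷ σ) i i' = i m < i' m ⊎ (i m ≡ i' m × LexLe σ i i')

lexLe? : ∀ {r} (σ : Ordering r) (i i' : Coord r) → Dec (LexLe σ i i')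
lexLe? []      i i' = yes tt
lexLe? (m ∷ σ) i i' = (i m <? i' m) ⊎-dec ((i m ≟ i' m) ×-dec lexLe? σ i i')

Sorted : ∀ {r} → Ordering r → List (Coord r) → Set
Sorted σ = Linked (LexLe σ)

sorted? : ∀ {r} (σ : Ordering r) (A : List (Coord r)) → Dec (Sorted σ A)
sorted? σ = linked? (lexLe? σ)

-- A complete ordering: a permutation of (1,…,r).
-- (used in the statement via _↭_ from the stdlib)

insert : ∀ {r} → Ordering r → Coord r → List (Coord r) → List (Coord r)
insert σ x []       = x ∷ []
insert σ x (y ∷ ys) = if does (lexLe? σ x y) then x ∷ y ∷ ys else y ∷ insert σ x ys

isort : ∀ {r} → Ordering r → List (Coord r) → List (Coord r)
isort σ []       = []
isort σ (x ∷ xs) = insert σ x (isort σ xs)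

after : ∀ {r} → Ordering r → Fin r → Ordering r
after []      p = []
after (m ∷ τ) p = if does (m ≟F p) then τ else after τ p

subset : ∀ {r} → Ordering r → Ordering r → Bool
subset xs ys = does (all? (λ x → any? (λ y → x ≟F y) ys) xs)

-- the state of the algorithm: the current list and the complete ordering τ
-- under which it is currently sorted.
State : ℕ → Set
State r = List (Coord r) × Ordering r

-- It is only defined (returns just) when its precondition holds:
-- A is sorted under τ, the given prefix is (τ_1,…,τ_l), and p = τ_k for
-- some k > l.  Its result is A rearranged to be sorted under
-- (τ_1,…,τ_l,τ_k,τ_{l+1},…,τ_{k-1},τ_{k+1},…,τ_r)  (unique, since that
-- ordering is complete), together with that new ordering.
partialSort : ∀ {r} → State r → Ordering r → Fin r → Maybe (State r)
partialSort {r} (A , τ) pre p =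
  if does (sorted? τ A)
     ∧ does (Data.List.Relation.Binary.Pointwise.decidable _≟F_ (take l τ) pre)
     ∧ does (any? (λ q → q ≟F p) (drop l τ))
  then just (isort τ' A , τ')
  else nothing
  where
  open import Data.List using (length)
  import Data.List.Relation.Binary.Pointwise
  l = length pre
  τ' = pre ++ (p ∷ filter (λ q → ¬? (q ≟F p)) (drop l τ))
    where open import Relation.Nullary using (¬?)

-- 0-based list access (σ_{j+1} = nth σ j)
nth : ∀ {A : Set} → List A → ℕ → Maybe A
nth []       _       = nothing
nth (x ∷ xs) zero    = just x
nth (x ∷ xs) (suc j) = nth xs j

module Quesadilla {r : ℕ} (σ : Ordering r) where

  -- loop condition  f(σ,σ_{k+1}) ⊈ f((1,…,r),σ_{k+1})
  notSub : ℕ → Bool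
  notSub k with nth σ k
  ... | nothing = false
  ... | just p  = not (subset (after σ p) (after (allFin r) p))

  -- while k+1 < r and cond(k): k ← k+1   (fuel bounds the iterations)
  scanK : ℕ → ℕ → ℕ
  scanK zero    k = k
  scanK (suc f) k = if (suc k <ᵇ r) ∧ notSub k then scanK f (suc k) else k

  -- while k > l: A ← PartialSort(A,(σ_1..σ_l),σ_k); k ← k-1
  -- (d = k - l remaining calls)
  inner : ℕ → ℕ → State r → Maybe (State r)
  inner l zero    s = just s
  inner l (suc d) s =
    nth σ (l + d) >>= λ p →
    partialSort s (take l σ) p >>= λ s' →
    inner l d s'

  outer : ℕ → ℕ → State r → Maybe (State r)
  outer zero    l s = if l <ᵇ r then nothing else just s
  outer (suc f) l s =
    if l <ᵇ r
    then (let k = scanK r l in inner l (k ∸ l) s >>= outer f (suc k))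
    else just s

-- QuesadillaSort(A,σ): starts from A sorted under (1,…,r).
-- Returns nothing if some PartialSort call's precondition fails.
quesadillaSort : ∀ {r} → List (Coord r) → Ordering r → Maybe (List (Coord r))
quesadillaSort {r} A σ =
  Data.Maybe.map proj₁ (Quesadilla.outer σ r 0 (A , allFin r))

-- Write τ for the ordering under which the current list is sorted.  Whenever the outer
-- loop reaches position l, τ is σ₁ … σ_l followed by the remaining modes in increasing
-- order.  The inner loop moves σ_k, σ_{k-1}, …, σ_{l+1} in turn to the front of the
-- unfixed part, leaving σ₁ … σ_k followed by the remaining modes in increasing order.
-- The scan stopped at k because every mode after σ_{k+1} in σ is larger than σ_{k+1}
-- (or there is none), so σ_{k+1} is the least remaining mode and τ now agrees with σ up
-- to position k+1.  Since PartialSort is realised by re-sorting the whole list, the list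
-- is always sorted under τ; what matters is that every call meets its precondition and
-- that τ ends as σ.

module Submission where

open import Defs
open import Data.Nat using (ℕ; zero; suc; _+_; _∸_; _<ᵇ_; s<s; z<s)
open import Data.Nat.Properties using (+-suc; +-identityʳ; m<m+n; m+n∸m≡n)
import Data.Nat as ℕ
import Data.Nat.Properties as ℕₚ
open import Data.Fin using (Fin; _<_)
open import Data.Fin.Properties using (_≟_; <-asym; <-irrefl; <⇒≢)
open import Data.List
  using (List; []; _∷_; _++_; [_]; _∷ʳ_; take; drop; length; filter; allFin; tabulate)
open import Data.List.Properties
  using (++-assoc; ∷ʳ-++; length-++; length-tabulate; filter-++; filter-all)
open import Data.List.Reverse using (Reverse; reverseView; []; _∶_∶ʳ_)
open import Data.List.Membership.Propositional using (_∈_; _∉_)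
open import Data.List.Membership.Propositional.Properties
  using (∈-allFin; ∈-filter⁺; ∈-filter⁻; ∈-++⁺ˡ; ∈-++⁺ʳ; ∈-++⁻)
open import Data.List.Relation.Unary.Any as Any using (here; there; any?)
open import Data.List.Relation.Unary.All as All using (All; []; _∷_; all?)
open import Data.List.Relation.Unary.AllPairs using (AllPairs; []; _∷_)
import Data.List.Relation.Unary.All.Properties as Allₚ
import Data.List.Relation.Unary.AllPairs.Properties as AllPairs
open import Data.List.Relation.Unary.Linked using ([]; [-]; _∷_)
open import Data.List.Relation.Unary.Unique.Propositional using (Unique)
open import Data.List.Relation.Unary.Unique.Propositional.Properties using (allFin⁺)
open import Data.List.Relation.Binary.Permutation.Propositional
  using (_↭_; ↭-refl; ↭-sym; ↭-trans; prep; swap; ↭⇒↭ₛ)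
open import Data.List.Relation.Binary.Permutation.Propositional.Properties
  using (∈-resp-↭; ↭-length; shift)
import Data.List.Relation.Binary.Permutation.Setoid.Properties as Permutationₛ
import Data.List.Relation.Binary.Pointwise as Pointwise
open import Data.Bool using (true; false; T; not)
open import Data.Bool.Properties using (T-≡)
open import Data.Maybe using (just; _>>=_)
open import Data.Product using (∃-syntax; _×_; _,_; proj₁)
open import Data.Sum using (inj₁; inj₂)
open import Data.Unit using (tt)
open import Data.Empty using (⊥-elim)
open import Function using (Equivalence)
open import Relation.Nullary using (yes; no; ¬_; ¬?; contradiction)
open import Relation.Nullary.Decidable using (dec-true)
open import Relation.Binary.Definitions using (tri<; tri≈; tri>)
open import Relation.Binary.PropositionalEquality
  using (_≡_; _≢_; ≢-sym; refl; sym; trans; cong; cong₂; subst; setoid; module ≡-Reasoning)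

¬LexLe⇒LexLe : ∀ {r} (τ : Ordering r) {x y : Coord r} → ¬ LexLe τ x y → LexLe τ y x
¬LexLe⇒LexLe []      x≰y = ⊥-elim (x≰y tt)
¬LexLe⇒LexLe (m ∷ τ) {x} {y} x≰y with ℕₚ.<-cmp (x m) (y m)
... | tri< x<y _ _ = ⊥-elim (x≰y (inj₁ x<y))
... | tri≈ _ x≡y _ = inj₂ (sym x≡y , ¬LexLe⇒LexLe τ (λ x≤y → x≰y (inj₂ (x≡y , x≤y))))
... | tri> _ _ y<x = inj₁ y<x

module _ {r} (τ : Ordering r) where

  insert-sorted : ∀ x {ys} → Sorted τ ys → Sorted τ (insert τ x ys)
  insert-sorted x []    = [-]
  insert-sorted x {y ∷ ys} y∷ys↗ with lexLe? τ x y
  ... | yes x≤y = x≤y ∷ y∷ys↗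
  ... | no  x≰y = go (¬LexLe⇒LexLe τ x≰y) y∷ys↗
    where
    go : ∀ {y ys} → LexLe τ y x → Sorted τ (y ∷ ys) → Sorted τ (y ∷ insert τ x ys)
    go {ys = []}     y≤x _ = y≤x ∷ [-]
    go {ys = z ∷ zs} y≤x (y≤z ∷ z∷zs↗) with lexLe? τ x z
    ... | yes x≤z = y≤x ∷ x≤z ∷ z∷zs↗
    ... | no  x≰z = y≤z ∷ go (¬LexLe⇒LexLe τ x≰z) z∷zs↗

  isort-sorted : ∀ xs → Sorted τ (isort τ xs)
  isort-sorted []       = []
  isort-sorted (x ∷ xs) = insert-sorted x (isort-sorted xs)

  insert-↭ : ∀ x ys → insert τ x ys ↭ x ∷ ys
  insert-↭ x []       = ↭-refl
  insert-↭ x (y ∷ ys) with lexLe? τ x y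
  ... | yes _ = ↭-refl
  ... | no  _ = ↭-trans (prep y (insert-↭ x ys)) (swap y x ↭-refl)

  isort-↭ : ∀ xs → isort τ xs ↭ xs
  isort-↭ []       = ↭-refl
  isort-↭ (x ∷ xs) = ↭-trans (insert-↭ x (isort τ xs)) (prep x (isort-↭ xs))

<⇒<ᵇ≡true : ∀ {m n} → m ℕ.< n → (m <ᵇ n) ≡ true
<⇒<ᵇ≡true m<n = Equivalence.to T-≡ (ℕₚ.<⇒<ᵇ m<n)

≮⇒<ᵇ≡false : ∀ {m n} → ¬ m ℕ.< n → (m <ᵇ n) ≡ false
≮⇒<ᵇ≡false {m} {n} m≮n with m <ᵇ n in m<ᵇn
... | false = refl
... | true  = contradiction (ℕₚ.<ᵇ⇒< m n (subst T (sym m<ᵇn) tt)) m≮n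

not≡false⇒T : ∀ {b} → not b ≡ false → T b
not≡false⇒T {true} _ = tt

module _ {A : Set} where

  take-length-++ : ∀ (xs ys : List A) → take (length xs) (xs ++ ys) ≡ xs
  take-length-++ []       ys = refl
  take-length-++ (x ∷ xs) ys = cong (x ∷_) (take-length-++ xs ys)

  drop-length-++ : ∀ (xs ys : List A) → drop (length xs) (xs ++ ys) ≡ ys
  drop-length-++ []       ys = refl
  drop-length-++ (x ∷ xs) ys = drop-length-++ xs ys

  length-∷ʳ : ∀ (xs : List A) x → length (xs ∷ʳ x) ≡ suc (length xs)
  length-∷ʳ []       x = refl
  length-∷ʳ (_ ∷ xs) x = cong suc (length-∷ʳ xs x)

  suffix-length-≤ : ∀ (X : List A) {x xs y ys} → x ∷ xs ≡ X ++ y ∷ ys → length ys ℕ.≤ length xs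
  suffix-length-≤ X {xs = xs} {ys = ys} x∷xs≡ =
    ℕₚ.≤-trans (ℕₚ.m≤n+m (length ys) (length X)) (ℕₚ.≤-reflexive (sym (ℕₚ.suc-injective lengths)))
    where
    lengths : suc (length xs) ≡ suc (length X + length ys)
    lengths = trans (cong length x∷xs≡) (trans (length-++ X) (+-suc (length X) (length ys)))

  ++-assoc-∷ʳ : ∀ (xs ys : List A) z zs → xs ++ ys ++ z ∷ zs ≡ ((xs ++ ys) ∷ʳ z) ++ zs
  ++-assoc-∷ʳ xs ys z zs = trans (sym (++-assoc xs ys (z ∷ zs))) (sym (∷ʳ-++ (xs ++ ys) z zs))

  nth-length : ∀ (xs : List A) y ys → nth (xs ++ y ∷ ys) (length xs) ≡ just y
  nth-length []       y ys = refl
  nth-length (x ∷ xs) y ys = nth-length xs y ys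

  ∈-tail : ∀ {x y} {ys : List A} → x ≢ y → x ∈ y ∷ ys → x ∈ ys
  ∈-tail x≢y (here x≡y)   = contradiction x≡y x≢y
  ∈-tail _   (there x∈ys) = x∈ys

  Unique-∉-middle : ∀ xs {x ys} → Unique (xs ++ x ∷ ys) → x ∉ xs ++ ys
  Unique-∉-middle xs {x} {ys} u x∈xs++ys
    with x≢xs++ys ∷ _ ← Permutationₛ.Unique-resp-↭ (setoid A) (↭⇒↭ₛ (shift x xs ys)) u
    = All.lookup x≢xs++ys x∈xs++ys refl

  tabulate⁺-< : ∀ {n} {R : A → A → Set} {f : Fin n → A} →
                (∀ {i j} → i < j → R (f i) (f j)) → AllPairs R (tabulate f)
  tabulate⁺-< {zero}  f-mono = []
  tabulate⁺-< {suc n} f-mono =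
    Allₚ.tabulate⁺ (λ _ → f-mono z<s) ∷ tabulate⁺-< (λ i<j → f-mono (s<s i<j))

module _ {r : ℕ} where

  allFin-increasing : AllPairs _<_ (allFin r)
  allFin-increasing = tabulate⁺-< (λ i<j → i<j)

  after-++ : ∀ xs (y : Fin r) ys → y ∉ xs → after (xs ++ y ∷ ys) y ≡ ys
  after-++ []       y ys y∉xs with y ≟ y
  ... | yes _   = refl
  ... | no  y≢y = contradiction refl y≢y
  after-++ (x ∷ xs) y ys y∉x∷xs with x ≟ y
  ... | yes refl = contradiction (here refl) y∉x∷xs
  ... | no  _    = after-++ xs y ys (λ y∈xs → y∉x∷xs (there y∈xs))

  after-increasing : ∀ {L : List (Fin r)} {y q} → AllPairs _<_ L → q ∈ after L y → y < q
  after-increasing {x ∷ L} {y} (x<L ∷ L↗) q∈after with x ≟ y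
  ... | yes refl = All.lookup x<L q∈after
  ... | no  _    = after-increasing L↗ q∈after

  subset-sound : ∀ (xs ys : List (Fin r)) → T (subset xs ys) → All (_∈ ys) xs
  subset-sound xs ys holds with all? (λ x → any? (λ y → x ≟ y) ys) xs
  ... | yes xs⊆ys = xs⊆ys

  least-elements-≡ : ∀ {n y : Fin r} {N ys} → All (n <_) N → All (y <_) ys →
                     n ∈ y ∷ ys → y ∈ n ∷ N → n ≡ y
  least-elements-≡ _   _    (here n≡y)   _          = n≡y
  least-elements-≡ _   y<ys (there n∈ys) (here y≡n) =
    contradiction (All.lookup y<ys n∈ys) (<-irrefl y≡n)
  least-elements-≡ n<N y<ys (there n∈ys) (there y∈N) =
    contradiction (All.lookup n<N y∈N) (<-asym (All.lookup y<ys n∈ys))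

  record _Enumerates_ (N S : List (Fin r)) : Set where
    field
      increasing : AllPairs _<_ N
      sound      : ∀ {q} → q ∈ N → q ∈ S
      complete   : ∀ {q} → q ∈ S → q ∈ N

  open _Enumerates_

  allFin-enumerates : ∀ {σ} → σ ↭ allFin r → allFin r Enumerates σ
  allFin-enumerates σ↭allFin = record
    { increasing = allFin-increasing
    ; sound      = λ {q} _ → ∈-resp-↭ (↭-sym σ↭allFin) (∈-allFin q)
    ; complete   = λ {q} _ → ∈-allFin q
    }

  enumerates-[] : ∀ {N} → N Enumerates [] → N ≡ []
  enumerates-[] {[]}    _    = refl
  enumerates-[] {n ∷ N} enum with () ← sound enum (here refl)

  enumerates-∷ : ∀ {N y ys} → N Enumerates (y ∷ ys) → All (y <_) ys →
                 ∃[ N′ ] (N ≡ y ∷ N′ × N′ Enumerates ys)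
  enumerates-∷ {[]}     enum _ with () ← complete enum (here refl)
  enumerates-∷ {n ∷ N′} {y} {ys} enum y<ys
    with n<N′ ∷ N′↗ ← increasing enum
    with refl ← least-elements-≡ n<N′ y<ys (sound enum (here refl)) (complete enum (here refl))
    = N′ , refl , record
      { increasing = N′↗
      ; sound      = λ q∈N′ → ∈-tail (≢-sym (<⇒≢ (All.lookup n<N′ q∈N′))) (sound enum (there q∈N′))
      ; complete   = λ q∈ys → ∈-tail (≢-sym (<⇒≢ (All.lookup y<ys q∈ys))) (complete enum (there q∈ys))
      }

  without : Fin r → List (Fin r) → List (Fin r)
  without p = filter (λ q → ¬? (q ≟ p))

  without-++ : ∀ {p} xs ys → p ∉ xs → without p (xs ++ ys) ≡ xs ++ without p ys
  without-++ {p} xs ys p∉xs = trans (filter-++ _ xs ys)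
    (cong (_++ without p ys) (filter-all _ (All.tabulate (λ { q∈xs refl → p∉xs q∈xs }))))

  without-enumerates : ∀ {N} xs {p ys} → N Enumerates (xs ++ p ∷ ys) → p ∉ xs ++ ys →
                       without p N Enumerates (xs ++ ys)
  without-enumerates xs {p} {ys} enum p∉xs++ys = record
    { increasing = AllPairs.filter⁺ _ (increasing enum)
    ; sound      = λ q∈ → let q∈N , q≢p = ∈-filter⁻ _ q∈ in
                     ∈-tail q≢p (∈-resp-↭ (shift p xs ys) (sound enum q∈N))
    ; complete   = λ q∈xs++ys → ∈-filter⁺ _
                     (complete enum (∈-resp-↭ (↭-sym (shift p xs ys)) (there q∈xs++ys)))
                     (λ { refl → p∉xs++ys q∈xs++ys })
    }

partialSort-≡ : ∀ {r} {B : List (Coord r)} pre M {p} → Sorted (pre ++ M) B → p ∈ M →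
                let τ′ = pre ++ p ∷ without p M in
                partialSort (B , pre ++ M) pre p ≡ just (isort τ′ B , τ′)
partialSort-≡ {B = B} pre M {p} B↗ p∈M
  rewrite take-length-++ pre M | drop-length-++ pre M
        | dec-true (sorted? (pre ++ M) B) B↗
        | dec-true (Pointwise.decidable _≟_ pre pre) (Pointwise.≡⇒Pointwise-≡ refl)
        | dec-true (any? (_≟ p) M) (Any.map sym p∈M)
  = refl

module Correctness {r} (σ : Ordering r) (σ↭allFin : σ ↭ allFin r) (A : List (Coord r)) where

  open Quesadilla σ
  open _Enumerates_

  Valid : State r → Set
  Valid (B , τ) = B ↭ A × Sorted τ B

  isort-valid : ∀ τ {B} → B ↭ A → Valid (isort τ B , τ)
  isort-valid τ {B} B↭A = ↭-trans (isort-↭ τ B) B↭A , isort-sorted τ B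

  σ-unique : Unique σ
  σ-unique = Permutationₛ.Unique-resp-↭ (setoid (Fin r)) (↭⇒↭ₛ (↭-sym σ↭allFin)) (allFin⁺ r)

  ∉-split : ∀ xs {x ys} → σ ≡ xs ++ x ∷ ys → x ∉ xs ++ ys
  ∉-split xs σ≡ = Unique-∉-middle xs (subst Unique σ≡ σ-unique)

  length-split : ∀ xs {ys} → σ ≡ xs ++ ys → r ≡ length xs + length ys
  length-split xs {ys} σ≡ = begin
    r                      ≡⟨ trans (↭-length σ↭allFin) (length-tabulate (λ i → i)) ⟨
    length σ               ≡⟨ cong length σ≡ ⟩
    length (xs ++ ys)      ≡⟨ length-++ xs ⟩
    length xs + length ys  ∎
    where open ≡-Reasoning

  nth-split : ∀ xs {y ys} → σ ≡ xs ++ y ∷ ys → nth σ (length xs) ≡ just y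
  nth-split xs {y} {ys} σ≡ = trans (cong (λ τ → nth τ (length xs)) σ≡) (nth-length xs y ys)

  after-split : ∀ xs {y ys} → σ ≡ xs ++ y ∷ ys → after σ y ≡ ys
  after-split xs {y} {ys} σ≡ =
    trans (cong (λ τ → after τ y) σ≡) (after-++ xs y ys (λ y∈xs → ∉-split xs σ≡ (∈-++⁺ˡ y∈xs)))

  notSub-false⇒increasing : ∀ xs {y ys} → σ ≡ xs ++ y ∷ ys →
                            notSub (length xs) ≡ false → All (y <_) ys
  notSub-false⇒increasing xs {y} {ys} σ≡ stop with nth σ (length xs) | nth-split xs σ≡
  ... | just .y | refl =
    All.map (after-increasing allFin-increasing)
      (subst (All (_∈ after (allFin r) y)) (after-split xs σ≡) (subset-sound _ _ (not≡false⇒T stop)))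

  length-≤-r : ∀ xs {ys} → σ ≡ xs ++ ys → length ys ℕ.≤ r
  length-≤-r xs {ys} σ≡ =
    subst (length ys ℕ.≤_) (sym (length-split xs σ≡)) (ℕₚ.m≤n+m (length ys) (length xs))

  last-position : ∀ xs {y} → σ ≡ xs ++ [ y ] → ¬ suc (length xs) ℕ.< r
  last-position xs σ≡ = ℕₚ.<-irrefl (sym (trans (length-split xs σ≡) (ℕₚ.+-comm (length xs) 1)))

  inner-position : ∀ xs {y z zs} → σ ≡ xs ++ y ∷ z ∷ zs → suc (length xs) ℕ.< r
  inner-position xs {zs = zs} σ≡ =
    subst (suc (length xs) ℕ.<_) (sym (trans (length-split xs σ≡) (+-suc (length xs) _)))
      (s<s (m<m+n (length xs) z<s))

  scanK-stops : ∀ fuel xs {y ys} → σ ≡ xs ++ y ∷ ys → length ys ℕ.< fuel →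
                ∃[ X ] ∃[ y′ ] ∃[ ys′ ] ( y ∷ ys ≡ X ++ y′ ∷ ys′
                                       × scanK fuel (length xs) ≡ length xs + length X
                                       × All (y′ <_) ys′)
  scanK-stops zero    _ _ ()
  scanK-stops (suc f) xs {y} {[]} σ≡ _
    rewrite ≮⇒<ᵇ≡false (last-position xs σ≡) = [] , y , [] , refl , sym (+-identityʳ _) , []
  scanK-stops (suc f) xs {y} {z ∷ zs} σ≡ (ℕ.s≤s zs<f)
    rewrite <⇒<ᵇ≡true (inner-position xs σ≡) with notSub (length xs) in stop
  ... | false = [] , y , z ∷ zs , refl , sym (+-identityʳ _) , notSub-false⇒increasing xs σ≡ stop
  ... | true
    with X , y′ , ys′ , z∷zs≡ , scan≡ , y′<ys′
           ← scanK-stops f (xs ∷ʳ y) (trans σ≡ (sym (++-assoc xs [ y ] (z ∷ zs)))) zs<f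
    = y ∷ X , y′ , ys′ , cong (y ∷_) z∷zs≡ , scan-steps , y′<ys′
    where
    open ≡-Reasoning
    scan-steps : scanK f (suc (length xs)) ≡ length xs + suc (length X)
    scan-steps = begin
      scanK f (suc (length xs))       ≡⟨ cong (scanK f) (length-∷ʳ xs y) ⟨
      scanK f (length (xs ∷ʳ y))      ≡⟨ scan≡ ⟩
      length (xs ∷ʳ y) + length X     ≡⟨ cong (_+ length X) (length-∷ʳ xs y) ⟩
      suc (length xs + length X)      ≡⟨ +-suc (length xs) (length X) ⟨
      length xs + suc (length X)      ∎

  inner-step : ∀ Pre Y {p Z T N B} → σ ≡ Pre ++ Y ++ p ∷ Z ++ T →
               N Enumerates (Y ++ p ∷ T) → Valid (B , Pre ++ Z ++ N) →
               let τ = Pre ++ p ∷ Z ++ without p N in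
               inner (length Pre) (length (Y ∷ʳ p)) (B , Pre ++ Z ++ N)
                 ≡ inner (length Pre) (length Y) (isort τ B , τ)
               × without p N Enumerates (Y ++ T) × Valid (isort τ B , τ)
  inner-step Pre Y {p} {Z} {T} {N} {B} σ≡ N-enum (B↭A , B↗) =
    inner-unfolds , without-enumerates Y N-enum p∉Y++T , isort-valid _ B↭A
    where
    open ≡-Reasoning
    l d : ℕ
    l = length Pre
    d = length Y
    s : State r
    s = (B , Pre ++ Z ++ N)
    τ : Ordering r
    τ = Pre ++ p ∷ Z ++ without p N
    σ≡′ : σ ≡ (Pre ++ Y) ++ p ∷ Z ++ T
    σ≡′ = trans σ≡ (sym (++-assoc Pre Y _))
    p∉Y++T : p ∉ Y ++ T
    p∉Y++T p∈Y++T with ∈-++⁻ Y p∈Y++T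
    ... | inj₁ p∈Y = ∉-split (Pre ++ Y) σ≡′ (∈-++⁺ˡ (∈-++⁺ʳ Pre p∈Y))
    ... | inj₂ p∈T = ∉-split (Pre ++ Y) σ≡′ (∈-++⁺ʳ (Pre ++ Y) (∈-++⁺ʳ Z p∈T))
    p∉Z : p ∉ Z
    p∉Z p∈Z = ∉-split (Pre ++ Y) σ≡′ (∈-++⁺ʳ (Pre ++ Y) (∈-++⁺ˡ p∈Z))
    nth≡ : nth σ (l + d) ≡ just p
    nth≡ = subst (λ i → nth σ i ≡ just p) (length-++ Pre) (nth-split (Pre ++ Y) σ≡′)
    take≡ : take l σ ≡ Pre
    take≡ = trans (cong (take l) σ≡) (take-length-++ Pre _)
    p∈Z++N : p ∈ Z ++ N
    p∈Z++N = ∈-++⁺ʳ Z (complete N-enum (∈-++⁺ʳ Y (here refl)))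
    inner-unfolds : inner l (length (Y ∷ʳ p)) s ≡ inner l d (isort τ B , τ)
    inner-unfolds = begin
      inner l (length (Y ∷ʳ p)) s
        ≡⟨ cong (λ n → inner l n s) (length-∷ʳ Y p) ⟩
      inner l (suc d) s
        ≡⟨ cong (_>>= λ q → partialSort s (take l σ) q >>= inner l d) nth≡ ⟩
      (partialSort s (take l σ) p >>= inner l d)
        ≡⟨ cong (λ pre → partialSort s pre p >>= inner l d) take≡ ⟩
      (partialSort s Pre p >>= inner l d)
        ≡⟨ cong (_>>= inner l d) (partialSort-≡ Pre (Z ++ N) B↗ p∈Z++N) ⟩
      inner l d (isort (Pre ++ p ∷ without p (Z ++ N)) B , Pre ++ p ∷ without p (Z ++ N))
        ≡⟨ cong (λ M → inner l d (isort (Pre ++ p ∷ M) B , Pre ++ p ∷ M)) (without-++ Z N p∉Z) ⟩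
      inner l d (isort τ B , τ)
        ∎

  -- Y is the part of the block still to be moved (its last mode moves next), Z the part
  -- already moved, T the modes after the block.
  inner-moves : ∀ Pre {T Y} → Reverse Y → ∀ {Z N B} →
                σ ≡ Pre ++ Y ++ Z ++ T → N Enumerates (Y ++ T) → Valid (B , Pre ++ Z ++ N) →
                ∃[ B′ ] ∃[ N′ ] ( inner (length Pre) (length Y) (B , Pre ++ Z ++ N)
                                    ≡ just (B′ , Pre ++ Y ++ Z ++ N′)
                                × N′ Enumerates T × Valid (B′ , Pre ++ Y ++ Z ++ N′))
  inner-moves Pre []               σ≡ N-enum valid = _ , _ , refl , N-enum , valid
  inner-moves Pre {T} (Y ∶ Y-view ∶ʳ p) {Z} σ≡ N-enum valid
    with σ≡′ ← trans σ≡ (cong (Pre ++_) (++-assoc Y [ p ] (Z ++ T)))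
    with step≡ , N₁-enum , valid₁
           ← inner-step Pre Y σ≡′
               (subst (_ Enumerates_) (++-assoc Y [ p ] T) N-enum) valid
    with B′ , N′ , inner≡ , N′-enum , valid′
           ← inner-moves Pre Y-view σ≡′ N₁-enum valid₁
    = B′ , N′ , trans step≡ (trans inner≡ (cong (λ τ → just (B′ , τ)) reassoc)) , N′-enum
    , subst (λ τ → Valid (B′ , τ)) reassoc valid′
    where
    reassoc : Pre ++ Y ++ p ∷ Z ++ N′ ≡ Pre ++ (Y ∷ʳ p) ++ Z ++ N′
    reassoc = cong (Pre ++_) (sym (++-assoc Y [ p ] (Z ++ N′)))

  outer-done : ∀ fuel {l} s → ¬ l ℕ.< r → outer fuel l s ≡ just s
  outer-done zero    s l≮r rewrite ≮⇒<ᵇ≡false l≮r = refl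
  outer-done (suc f) s l≮r rewrite ≮⇒<ᵇ≡false l≮r = refl

  outer-step : ∀ f {l} s → l ℕ.< r →
               outer (suc f) l s ≡ (inner l (scanK r l ∸ l) s >>= outer f (suc (scanK r l)))
  outer-step f s l<r rewrite <⇒<ᵇ≡true l<r = refl

  outer-sorts : ∀ fuel Pre {Suf N B} → σ ≡ Pre ++ Suf → length Suf ℕ.≤ fuel →
                N Enumerates Suf → Valid (B , Pre ++ N) →
                ∃[ B′ ] (outer fuel (length Pre) (B , Pre ++ N) ≡ just (B′ , σ) × Valid (B′ , σ))
  outer-sorts fuel Pre {[]} {B = B} σ≡ _ N-enum valid with refl ← enumerates-[] N-enum =
    B , trans (outer-done fuel _ (ℕₚ.<-irrefl (sym r≡l))) (cong (λ τ → just (B , τ)) (sym σ≡))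
      , subst (λ τ → Valid (B , τ)) (sym σ≡) valid
    where
    r≡l : r ≡ length Pre
    r≡l = trans (length-split Pre σ≡) (+-identityʳ _)
  outer-sorts (suc f) Pre {y ∷ ys} {N} {B} σ≡ (ℕ.s≤s ys≤f) N-enum valid
    with X , y′ , ys′ , y∷ys≡ , scan≡ , y′<ys′ ← scanK-stops r Pre σ≡ (length-≤-r Pre σ≡)
    with B₁ , N₁ , inner≡ , N₁-enum , valid₁
           ← inner-moves Pre (reverseView X) {Z = []} (trans σ≡ (cong (Pre ++_) y∷ys≡))
               (subst (N Enumerates_) y∷ys≡ N-enum) valid
    with N₂ , refl , N₂-enum ← enumerates-∷ N₁-enum y′<ys′
    with B′ , outer≡ , valid′
           ← outer-sorts f ((Pre ++ X) ∷ʳ y′)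
               (trans σ≡ (trans (cong (Pre ++_) y∷ys≡) (++-assoc-∷ʳ Pre X y′ ys′)))
               (ℕₚ.≤-trans (suffix-length-≤ X y∷ys≡) ys≤f) N₂-enum
               (subst (λ τ → Valid (B₁ , τ)) (++-assoc-∷ʳ Pre X y′ N₂) valid₁)
    = B′ , outer-unfolds , valid′
    where
    open ≡-Reasoning
    l : ℕ
    l = length Pre
    s : State r
    s = (B , Pre ++ N)
    outer-unfolds : outer (suc f) l s ≡ just (B′ , σ)
    outer-unfolds = begin
      outer (suc f) l s
        ≡⟨ outer-step f s (subst (l ℕ.<_) (sym (length-split Pre σ≡)) (m<m+n l z<s)) ⟩
      (inner l (scanK r l ∸ l) s >>= outer f (suc (scanK r l)))
        ≡⟨ cong (λ k → inner l (k ∸ l) s >>= outer f (suc k)) scan≡ ⟩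
      (inner l (l + length X ∸ l) s >>= outer f (suc (l + length X)))
        ≡⟨ cong₂ (λ d k → inner l d s >>= outer f k) (m+n∸m≡n l (length X))
             (sym (trans (length-∷ʳ (Pre ++ X) y′) (cong suc (length-++ Pre)))) ⟩
      (inner l (length X) s >>= outer f (length ((Pre ++ X) ∷ʳ y′)))
        ≡⟨ cong (_>>= outer f (length ((Pre ++ X) ∷ʳ y′))) inner≡ ⟩
      outer f (length ((Pre ++ X) ∷ʳ y′)) (B₁ , Pre ++ X ++ y′ ∷ N₂)
        ≡⟨ cong (λ τ → outer f (length ((Pre ++ X) ∷ʳ y′)) (B₁ , τ)) (++-assoc-∷ʳ Pre X y′ N₂) ⟩
      outer f (length ((Pre ++ X) ∷ʳ y′)) (B₁ , ((Pre ++ X) ∷ʳ y′) ++ N₂)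
        ≡⟨ outer≡ ⟩
      just (B′ , σ)
        ∎

theorem3p4 : ∀ {r : ℕ} (n : Fin r → ℕ) (A : List (Coord r)) (σ : Ordering r)
    → All (InBounds n) A
    → Sorted (allFin r) A
    → σ ↭ allFin r
    → ∃[ B ] (quesadillaSort A σ ≡ just B × B ↭ A × Sorted σ B)
-- The bounds on the indices play no role.
theorem3p4 {r} _ A σ _ A↗ σ↭allFin =
  let B , outer≡ , B↭A , B↗ = outer-sorts r [] refl (length-≤-r [] refl)
                                (allFin-enumerates σ↭allFin) (↭-refl , A↗)
  in B , cong (Data.Maybe.map proj₁) outer≡ , B↭A , B↗
  where open Correctness σ σ↭allFin A
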